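{- Let $n>1$ be an integer and let $\mathcal{H}_1,\mathcal{H}_2,\mathcal{H}_3$ be three (not necessarily distinct) HCS$(2n+1)$ on the vertex set $\{\infty\}\cup[2n]$. Write their cycles as $A_i=(\infty,\alpha_{i,1},\dots,\alpha_{i,2n})$, $B_i=(\infty,\beta_{i,1},\dots,\beta_{i,2n})$, $C_i=(\infty,\gamma_{i,1},\dots,\gamma_{i,2n})$ for $i\in[n]$, and assume $\alpha_{i,1}=\beta_{i,1}=\gamma_{i,1}$ and $\alpha_{i,2n}=\beta_{i,2n}=\gamma_{i,2n}$ for all $i\in[n]$. On $\{\infty\}\cup([2n]\times\{1,-1\})$ write $z'=(x,-y)$ for $z=(x,y)$, and $a_{ij}=(\alpha_{ij},1)$, $b_{ij}=(\beta_{ij},1)$, $c_{ij}=(\gamma_{ij},1)$. Let $\mathcal{T}=\{T_{i,1},T_{i,2}:i\in[n]\}$ where $$T_{i,1}=(\infty,a_{i,1},\dots,a_{i,2n},b'_{i,2n},\dots,b'_{i,1}),$$ $$T_{i,2}=(\infty,c_{i,2n},c'_{i,2n-1},c_{i,2n-2},\dots,c'_{i,1},c_{i,1},c'_{i,2},c_{i,3},\dots,c'_{i,2n}).$$ ($\mathcal{T}$ is an HCS$(4n+1)$.) Then every automorphism of $\mathcal{T}$ fixes the vertex $\infty$.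
   Context: An HCS$(v)$ is a set of Hamiltonian cycles of $K_v$ whose edge sets partition the edge set of $K_v$. An automorphism of an HCS is a permutation of the vertex set mapping the set of cycles onto itself. -}

module Defs where

open import Data.Nat using (ℕ; zero; suc; _*_; _<_)
open import Data.Fin using (Fin; toℕ)
open import Data.Bool using (Bool; true; false; not)
open import Data.Maybe using (Maybe; nothing; just)
open import Data.Product using (_×_; _,_; ∃)
open import Data.Sum using (_⊎_)
open import Data.List using (List; []; _∷_; _++_; map; zip; reverse; allFin)
open import Data.List.Membership.Propositional using (_∈_)
open import Relation.Binary.PropositionalEquality using (_≡_; _≢_)
open import Function.Base using (_∘_)
open import Function.Bundles using (_↔_; _⇔_; Inverse)
open import Function.Definitions using (Injective)

-- A cycle is written as a list of its vertices (v₀, v₁, …, v_{m-1});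
-- its edges are {vₖ, vₖ₊₁} (indices mod m).
cyclePairs : {A : Set} → List A → List (A × A)
cyclePairs [] = []
cyclePairs (x ∷ xs) = zip (x ∷ xs) (xs ++ x ∷ [])

IsEdge : {A : Set} → List A → A → A → Set
IsEdge c u v = ((u , v) ∈ cyclePairs c) ⊎ ((v , u) ∈ cyclePairs c)

-- HCS(2n+1) on {∞} ∪ [2n]; vertices Maybe (Fin (2n)), ∞ = nothing.
-- The cycle with sequence α : Fin (2n) → Fin (2n) is (∞, α 0, …, α (2n-1)).

baseCycle : (n : ℕ) → (Fin (2 * n) → Fin (2 * n)) → List (Maybe (Fin (2 * n)))
baseCycle n α = nothing ∷ map (just ∘ α) (allFin (2 * n))

-- The n cycles (∞, α i 0, …, α i (2n-1)), i ∈ Fin n, form an HCS(2n+1):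
-- each is Hamiltonian (α i is injective, hence visits every vertex once),
-- and their edge sets partition the edge set of K_{2n+1}.
IsHCSSeq : (n : ℕ) → (Fin n → Fin (2 * n) → Fin (2 * n)) → Set
IsHCSSeq n α =
  (∀ i → Injective _≡_ _≡_ (α i))
  × (∀ (u v : Maybe (Fin (2 * n))) → u ≢ v → ∃ λ i → IsEdge (baseCycle n (α i)) u v)
  × (∀ (u v : Maybe (Fin (2 * n))) (i j : Fin n) →
       IsEdge (baseCycle n (α i)) u v → IsEdge (baseCycle n (α j)) u v → i ≡ j)

-- Vertex set {∞} ∪ ([2n] × {1,-1}); true = 1, false = -1, ∞ = nothing.

TV : ℕ → Set
TV n = Maybe (Fin (2 * n) × Bool)

isEven : ℕ → Bool
isEven zero = true
isEven (suc k) = not (isEven k)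

T1 : (n : ℕ) → (α β : Fin n → Fin (2 * n) → Fin (2 * n)) → Fin n → List (TV n)
T1 n α β i =
  nothing ∷ (map (λ k → just (α i k , true)) (allFin (2 * n))
             ++ reverse (map (λ k → just (β i k , false)) (allFin (2 * n))))

-- T_{i,2} = (∞, c_{i,2n}, c'_{i,2n-1}, …, c'_{i,1}, c_{i,1}, c'_{i,2}, c_{i,3}, …, c'_{i,2n})
-- With 0-based index k (1-based index k+1): in the descending part the sign is
-- +1 iff k+1 is even; in the ascending part the sign is +1 iff k+1 is odd.
T2 : (n : ℕ) → (γ : Fin n → Fin (2 * n) → Fin (2 * n)) → Fin n → List (TV n)
T2 n γ i =
  nothing ∷ (reverse (map (λ k → just (γ i k , not (isEven (toℕ k)))) (allFin (2 * n)))
             ++ map (λ k → just (γ i k , isEven (toℕ k))) (allFin (2 * n)))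

Tcyc : (n : ℕ) → (α β γ : Fin n → Fin (2 * n) → Fin (2 * n)) → Fin n × Bool → List (TV n)
Tcyc n α β γ (i , true) = T1 n α β i
Tcyc n α β γ (i , false) = T2 n γ i

MapsCycle : {V : Set} → (V ↔ V) → List V → List V → Set
MapsCycle {V} σ c d = ∀ (u v : V) → IsEdge c u v ⇔ IsEdge d (Inverse.to σ u) (Inverse.to σ v)

IsAutT : (n : ℕ) → (α β γ : Fin n → Fin (2 * n) → Fin (2 * n)) → (TV n ↔ TV n) → Set
IsAutT n α β γ σ =
  (∀ t → ∃ λ s → MapsCycle σ (Tcyc n α β γ t) (Tcyc n α β γ s))
  × (∀ s → ∃ λ t → MapsCycle σ (Tcyc n α β γ t) (Tcyc n α β γ s))

EndsAgree : (n : ℕ) → (α β γ : Fin n → Fin (2 * n) → Fin (2 * n)) → Set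
EndsAgree n α β γ =
  ∀ (i : Fin n) (k : Fin (2 * n)) → (toℕ k ≡ 0 ⊎ suc (toℕ k) ≡ 2 * n) →
    (α i k ≡ β i k) × (α i k ≡ γ i k)

-- Call a vertex w rigid if for any two cycles t, s of 𝒯 whose two neighbours of w on t
-- are joined on s, the two neighbours of w on s are joined on t. Automorphisms map rigid
-- vertices to rigid vertices, and ∞ is rigid: its neighbours on any cycle are twins
-- (x , 1), (x , -1) with x an end of a γ-cycle, the twin edge at x lies on the cycle for
-- which x is the other end of that γ-cycle, and since every vertex is an end of exactly
-- one γ-cycle at exactly one end this relation between cycles is symmetric.
-- No other vertex is rigid. A vertex (x , ±1) is an end of some γ-cycle, so it lies on
-- some T_{i,2} next to its twin or next to ∞; its two neighbours there are joined on
-- some cycle s, determined by the α-, β- or γ-cycle through them, and its two neighbours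
-- on s turn out to have equal signs (or to be ∞ and a vertex not adjacent to ∞ on T_{i,2}),
-- whereas consecutive finite vertices of T_{i,2} always have opposite signs.
module Submission where

open import Data.Nat using (ℕ; zero; suc; pred; _*_; _<_; s≤s)
open import Data.Nat.Properties using (<-irrefl; 1+n≢0; m+n≡0⇒n≡0)
open import Data.Fin using (Fin; zero; suc; toℕ; inject₁; fromℕ; punchOut)
open import Data.Fin.Properties using (suc-injective; injective⇒≤; punchOut-injective; any?; 0≢1+n; toℕ-fromℕ; toℕ-inject₁; fromℕ≢inject₁) renaming (_≟_ to _≟ᶠ_)
open import Data.Fin.Relation.Unary.Top as Top using (‵fromℕ; ‵inject₁)
open import Data.List using (List; []; _∷_; _++_; zip; map; reverse; tabulate; allFin)
open import Data.List.Properties using (unfold-reverse; reverse-involutive; reverse-++; map-tabulate; ++-assoc)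
open import Data.List.Membership.Propositional using (_∈_)
open import Data.List.Relation.Unary.Any as Any using ()
open import Data.Product using (_×_; _,_; ∃; ∃₂; proj₁; proj₂)
open import Data.Product.Properties using (,-injectiveˡ)
open import Data.Bool using (Bool; true; false; not)
open import Data.Bool.Properties using (not-involutive; not-¬; ¬-not) renaming (_≟_ to _≟ᵇ_)
open import Data.Maybe using (nothing; just)
open import Data.Maybe.Properties using (just-injective)
open import Data.Sum using (_⊎_; inj₁; inj₂)
open import Data.Empty using (⊥; ⊥-elim)
open import Relation.Nullary using (¬_; yes; no)
open import Relation.Binary.PropositionalEquality using (_≡_; _≢_; refl; subst₂; sym; trans; cong; cong₂; subst; module ≡-Reasoning)
open import Function.Base using (_∘_)
open import Function.Bundles using (_↔_; Inverse; Equivalence)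
open import Function.Definitions using (Injective)
open ≡-Reasoning
open import Defs

module _ {A : Set} where

  data Adjacent : List A → A → A → Set where
    here  : ∀ {a b l} → Adjacent (a ∷ b ∷ l) a b
    there : ∀ {x l a b} → Adjacent l a b → Adjacent (x ∷ l) a b

  First : List A → A → Set
  First []      _ = ⊥
  First (x ∷ _) a = x ≡ a

  data Last : List A → A → Set where
    last-here  : ∀ {a} → Last (a ∷ []) a
    last-there : ∀ {x l a} → Last l a → Last (x ∷ l) a

  private
    variable
      u v x y : A
      l l₁ l₂ : List A

  ∈-zip-shift⁻ : ∀ xs → (u , v) ∈ zip (x ∷ xs) (xs ++ y ∷ []) → Adjacent (x ∷ xs ++ y ∷ []) u v
  ∈-zip-shift⁻ []       (Any.here refl)  = here
  ∈-zip-shift⁻ (_ ∷ _)  (Any.here refl)  = here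
  ∈-zip-shift⁻ (_ ∷ xs) (Any.there p)    = there (∈-zip-shift⁻ xs p)

  ∈-zip-shift⁺ : ∀ xs → Adjacent (x ∷ xs ++ y ∷ []) u v → (u , v) ∈ zip (x ∷ xs) (xs ++ y ∷ [])
  ∈-zip-shift⁺ []       here              = Any.here refl
  ∈-zip-shift⁺ []       (there (there ()))
  ∈-zip-shift⁺ (_ ∷ _)  here              = Any.here refl
  ∈-zip-shift⁺ (_ ∷ xs) (there p)         = Any.there (∈-zip-shift⁺ xs p)

  Adjacent-++⁻ : ∀ l₁ → Adjacent (l₁ ++ l₂) u v →
                 Adjacent l₁ u v ⊎ (Last l₁ u × First l₂ v) ⊎ Adjacent l₂ u v
  Adjacent-++⁻ []           p         = inj₂ (inj₂ p)
  Adjacent-++⁻ {l₂ = _ ∷ _} (x ∷ [])  here      = inj₂ (inj₁ (last-here , refl))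
  Adjacent-++⁻ (x ∷ [])     (there p) = inj₂ (inj₂ p)
  Adjacent-++⁻ (x ∷ y ∷ l₁) here      = inj₁ here
  Adjacent-++⁻ (x ∷ y ∷ l₁) (there p) with Adjacent-++⁻ (y ∷ l₁) p
  ... | inj₁ q                 = inj₁ (there q)
  ... | inj₂ (inj₁ (lu , fv))  = inj₂ (inj₁ (last-there lu , fv))
  ... | inj₂ (inj₂ q)          = inj₂ (inj₂ q)

  Adjacent-++⁺ˡ : ∀ l₂ → Adjacent l₁ u v → Adjacent (l₁ ++ l₂) u v
  Adjacent-++⁺ˡ _ here      = here
  Adjacent-++⁺ˡ _ (there p) = there (Adjacent-++⁺ˡ _ p)

  Adjacent-++⁺ʳ : ∀ l₁ → Adjacent l₂ u v → Adjacent (l₁ ++ l₂) u v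
  Adjacent-++⁺ʳ []       p = p
  Adjacent-++⁺ʳ (_ ∷ l₁) p = there (Adjacent-++⁺ʳ l₁ p)

  Adjacent-++⁺-join : ∀ l₂ → Last l₁ u → First l₂ v → Adjacent (l₁ ++ l₂) u v
  Adjacent-++⁺-join (_ ∷ _) last-here       refl = here
  Adjacent-++⁺-join l₂      (last-there lu) fv   = there (Adjacent-++⁺-join l₂ lu fv)

  Last-∷ʳ⁻ : ∀ l → Last (l ++ x ∷ []) u → x ≡ u
  Last-∷ʳ⁻ []          last-here       = refl
  Last-∷ʳ⁻ []          (last-there ())
  Last-∷ʳ⁻ (_ ∷ [])    (last-there lu) = Last-∷ʳ⁻ [] lu
  Last-∷ʳ⁻ (_ ∷ y ∷ l) (last-there lu) = Last-∷ʳ⁻ (y ∷ l) lu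

  Last-∷ʳ⁺ : ∀ l → Last (l ++ x ∷ []) x
  Last-∷ʳ⁺ []      = last-here
  Last-∷ʳ⁺ (_ ∷ l) = last-there (Last-∷ʳ⁺ l)

  Last-reverse⁻ : ∀ l → Last (reverse l) u → First l u
  Last-reverse⁻ (x ∷ l) lu rewrite unfold-reverse x l = Last-∷ʳ⁻ (reverse l) lu

  Last-reverse⁺ : ∀ l → First l u → Last (reverse l) u
  Last-reverse⁺ (x ∷ l) refl rewrite unfold-reverse x l = Last-∷ʳ⁺ (reverse l)

  First-reverse⁻ : ∀ l → First (reverse l) u → Last l u
  First-reverse⁻ l fu = subst (λ l′ → Last l′ _) (reverse-involutive l) (Last-reverse⁺ (reverse l) fu)

  First-reverse⁺ : ∀ l → Last l u → First (reverse l) u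
  First-reverse⁺ l lu = Last-reverse⁻ (reverse l) (subst (λ l′ → Last l′ _) (sym (reverse-involutive l)) lu)

  Adjacent-reverse⁺ : ∀ l → Adjacent l v u → Adjacent (reverse l) u v
  Adjacent-reverse⁺ (x ∷ y ∷ l) here rewrite unfold-reverse x (y ∷ l) =
    Adjacent-++⁺-join (x ∷ []) (Last-reverse⁺ (y ∷ l) refl) refl
  Adjacent-reverse⁺ (x ∷ l) (there p) rewrite unfold-reverse x l =
    Adjacent-++⁺ˡ (x ∷ []) (Adjacent-reverse⁺ l p)

  Adjacent-reverse⁻ : ∀ l → Adjacent (reverse l) u v → Adjacent l v u
  Adjacent-reverse⁻ l p = subst (λ l′ → Adjacent l′ _ _) (reverse-involutive l) (Adjacent-reverse⁺ (reverse l) p)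

  Adjacent-tabulate⁻ : ∀ {K} (f : Fin (suc K) → A) → Adjacent (tabulate f) u v →
                       ∃ λ k → u ≡ f (inject₁ k) × v ≡ f (suc k)
  Adjacent-tabulate⁻ {K = zero}  f (there ())
  Adjacent-tabulate⁻ {K = suc K} f here      = zero , refl , refl
  Adjacent-tabulate⁻ {K = suc K} f (there p) with Adjacent-tabulate⁻ (f ∘ suc) p
  ... | k , refl , refl = suc k , refl , refl

  Adjacent-tabulate⁺ : ∀ {K} (f : Fin (suc K) → A) k → Adjacent (tabulate f) (f (inject₁ k)) (f (suc k))
  Adjacent-tabulate⁺ f zero    = here
  Adjacent-tabulate⁺ f (suc k) = there (Adjacent-tabulate⁺ (f ∘ suc) k)

  Last-tabulate⁻ : ∀ {K} (f : Fin (suc K) → A) → Last (tabulate f) u → u ≡ f (fromℕ K)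
  Last-tabulate⁻ {K = zero}  f last-here       = refl
  Last-tabulate⁻ {K = zero}  f (last-there ())
  Last-tabulate⁻ {K = suc K} f (last-there lu) = Last-tabulate⁻ (f ∘ suc) lu

  Last-tabulate⁺ : ∀ {K} (f : Fin (suc K) → A) → Last (tabulate f) (f (fromℕ K))
  Last-tabulate⁺ {K = zero}  f = last-here
  Last-tabulate⁺ {K = suc K} f = last-there (Last-tabulate⁺ (f ∘ suc))

module _ {A : Set} where

  Step : List A → A → A → Set
  Step c u v = (u , v) ∈ cyclePairs c

  private
    variable
      u v : A

    map-allFin : ∀ {n} (f : Fin n → A) → map f (allFin n) ≡ tabulate f
    map-allFin f = map-tabulate (λ k → k) f

    Step⇒Adjacent : ∀ {z} xs {ws} → z ∷ xs ++ z ∷ [] ≡ ws → Step (z ∷ xs) u v → Adjacent ws u v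
    Step⇒Adjacent xs refl = ∈-zip-shift⁻ xs

    Adjacent⇒Step : ∀ {z} xs {ws} → z ∷ xs ++ z ∷ [] ≡ ws → Adjacent ws u v → Step (z ∷ xs) u v
    Adjacent⇒Step xs refl = ∈-zip-shift⁺ xs

  module _ {K : ℕ} (z : A) (p : Fin (suc K) → A) where

    loop : List A
    loop = z ∷ map p (allFin (suc K))

    data LoopStep : A → A → Set where
      enter : LoopStep z (p zero)
      walk  : ∀ k → LoopStep (p (inject₁ k)) (p (suc k))
      leave : LoopStep (p (fromℕ K)) z

    private
      loop-walk : z ∷ map p (allFin (suc K)) ++ z ∷ [] ≡ z ∷ tabulate p ++ z ∷ []
      loop-walk = cong (λ ps → z ∷ ps ++ z ∷ []) (map-allFin p)

    loop-step⁻ : Step loop u v → LoopStep u v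
    loop-step⁻ st with Step⇒Adjacent (map p (allFin (suc K))) loop-walk st
    ... | here = enter
    ... | there adj with Adjacent-++⁻ (tabulate p) adj
    ...   | inj₁ adj′ with Adjacent-tabulate⁻ p adj′
    ...     | k , refl , refl = walk k
    loop-step⁻ st | there adj | inj₂ (inj₁ (lu , refl)) with Last-tabulate⁻ p lu
    ...     | refl = leave
    loop-step⁻ st | there adj | inj₂ (inj₂ (there ()))

    loop-step⁺ : LoopStep u v → Step loop u v
    loop-step⁺ s = Adjacent⇒Step (map p (allFin (suc K))) loop-walk (adjacent s)
      where
      adjacent : LoopStep u v → Adjacent (z ∷ tabulate p ++ z ∷ []) u v
      adjacent enter    = here
      adjacent (walk k) = there (Adjacent-++⁺ˡ (z ∷ []) (Adjacent-tabulate⁺ p k))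
      adjacent leave    = there (Adjacent-++⁺-join (z ∷ []) (Last-tabulate⁺ p) refl)

  module _ {K : ℕ} (z : A) (p q : Fin (suc K) → A) where

    outBack : List A
    outBack = z ∷ (map p (allFin (suc K)) ++ reverse (map q (allFin (suc K))))

    data OutBackStep : A → A → Set where
      enter : OutBackStep z (p zero)
      out   : ∀ k → OutBackStep (p (inject₁ k)) (p (suc k))
      turn  : OutBackStep (p (fromℕ K)) (q (fromℕ K))
      back  : ∀ k → OutBackStep (q (suc k)) (q (inject₁ k))
      leave : OutBackStep (q zero) z

    private
      outBack-walk : z ∷ (map p (allFin (suc K)) ++ reverse (map q (allFin (suc K)))) ++ z ∷ []
                     ≡ (z ∷ tabulate p) ++ reverse (z ∷ tabulate q)
      outBack-walk = cong (z ∷_) (begin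
        (map p (allFin (suc K)) ++ reverse (map q (allFin (suc K)))) ++ z ∷ []
          ≡⟨ cong₂ (λ ps qs → (ps ++ reverse qs) ++ z ∷ []) (map-allFin p) (map-allFin q) ⟩
        (tabulate p ++ reverse (tabulate q)) ++ z ∷ []
          ≡⟨ ++-assoc (tabulate p) (reverse (tabulate q)) (z ∷ []) ⟩
        tabulate p ++ reverse (tabulate q) ++ z ∷ []
          ≡⟨ cong (tabulate p ++_) (sym (unfold-reverse z (tabulate q))) ⟩
        tabulate p ++ reverse (z ∷ tabulate q) ∎)

    outBack-step⁻ : Step outBack u v → OutBackStep u v
    outBack-step⁻ st with Step⇒Adjacent (map p (allFin (suc K)) ++ reverse (map q (allFin (suc K)))) outBack-walk st
    ... | here = enter
    ... | there adj with Adjacent-++⁻ (tabulate p) adj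
    ...   | inj₁ adj′ with Adjacent-tabulate⁻ p adj′
    ...     | k , refl , refl = out k
    outBack-step⁻ st | there adj | inj₂ (inj₁ (lu , fv)) with First-reverse⁻ (z ∷ tabulate q) fv
    ...     | last-there lv with Last-tabulate⁻ p lu | Last-tabulate⁻ q lv
    ...       | refl | refl = turn
    outBack-step⁻ st | there adj | inj₂ (inj₂ adj′) with Adjacent-reverse⁻ (z ∷ tabulate q) adj′
    ...     | here = leave
    ...     | there adj″ with Adjacent-tabulate⁻ q adj″
    ...       | k , refl , refl = back k

    outBack-step⁺ : OutBackStep u v → Step outBack u v
    outBack-step⁺ s = Adjacent⇒Step (map p (allFin (suc K)) ++ reverse (map q (allFin (suc K)))) outBack-walk (adjacent s)
      where
      adjacent : OutBackStep u v → Adjacent ((z ∷ tabulate p) ++ reverse (z ∷ tabulate q)) u v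
      adjacent enter    = here
      adjacent (out k)  = there (Adjacent-++⁺ˡ _ (Adjacent-tabulate⁺ p k))
      adjacent turn     = there (Adjacent-++⁺-join _ (Last-tabulate⁺ p)
                                   (First-reverse⁺ (z ∷ tabulate q) (last-there (Last-tabulate⁺ q))))
      adjacent (back k) = Adjacent-++⁺ʳ (z ∷ tabulate p) (Adjacent-reverse⁺ _ (there (Adjacent-tabulate⁺ q k)))
      adjacent leave    = Adjacent-++⁺ʳ (z ∷ tabulate p) (Adjacent-reverse⁺ (z ∷ tabulate q) here)

    backOut : List A
    backOut = z ∷ (reverse (map p (allFin (suc K))) ++ map q (allFin (suc K)))

    data BackOutStep : A → A → Set where
      enter : BackOutStep z (p (fromℕ K))
      back  : ∀ k → BackOutStep (p (suc k)) (p (inject₁ k))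
      turn  : BackOutStep (p zero) (q zero)
      out   : ∀ k → BackOutStep (q (inject₁ k)) (q (suc k))
      leave : BackOutStep (q (fromℕ K)) z

    private
      backOut-walk : z ∷ (reverse (map p (allFin (suc K))) ++ map q (allFin (suc K))) ++ z ∷ []
                     ≡ reverse (tabulate p ++ z ∷ []) ++ tabulate q ++ z ∷ []
      backOut-walk = begin
        z ∷ (reverse (map p (allFin (suc K))) ++ map q (allFin (suc K))) ++ z ∷ []
          ≡⟨ cong₂ (λ ps qs → z ∷ (reverse ps ++ qs) ++ z ∷ []) (map-allFin p) (map-allFin q) ⟩
        z ∷ (reverse (tabulate p) ++ tabulate q) ++ z ∷ []
          ≡⟨ cong (z ∷_) (++-assoc (reverse (tabulate p)) (tabulate q) (z ∷ [])) ⟩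
        z ∷ reverse (tabulate p) ++ tabulate q ++ z ∷ []
          ≡⟨ cong (_++ tabulate q ++ z ∷ []) (sym (reverse-++ (tabulate p) (z ∷ []))) ⟩
        reverse (tabulate p ++ z ∷ []) ++ tabulate q ++ z ∷ [] ∎

    backOut-step⁻ : Step backOut u v → BackOutStep u v
    backOut-step⁻ st with Adjacent-++⁻ (reverse (tabulate p ++ z ∷ []))
                            (Step⇒Adjacent (reverse (map p (allFin (suc K))) ++ map q (allFin (suc K))) backOut-walk st)
    ... | inj₁ adj with Adjacent-++⁻ (tabulate p) (Adjacent-reverse⁻ (tabulate p ++ z ∷ []) adj)
    ...   | inj₁ adj′ with Adjacent-tabulate⁻ p adj′
    ...     | k , refl , refl = back k
    backOut-step⁻ st | inj₁ adj | inj₂ (inj₁ (lv , refl)) with Last-tabulate⁻ p lv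
    ...     | refl = enter
    backOut-step⁻ st | inj₁ adj | inj₂ (inj₂ (there ()))
    backOut-step⁻ st | inj₂ (inj₁ (lu , refl)) with Last-reverse⁻ (tabulate p ++ z ∷ []) lu
    ...   | refl = turn
    backOut-step⁻ st | inj₂ (inj₂ adj) with Adjacent-++⁻ (tabulate q) adj
    ...   | inj₁ adj′ with Adjacent-tabulate⁻ q adj′
    ...     | k , refl , refl = out k
    backOut-step⁻ st | inj₂ (inj₂ adj) | inj₂ (inj₁ (lu , refl)) with Last-tabulate⁻ q lu
    ...     | refl = leave
    backOut-step⁻ st | inj₂ (inj₂ adj) | inj₂ (inj₂ (there ()))

    backOut-step⁺ : BackOutStep u v → Step backOut u v
    backOut-step⁺ s = Adjacent⇒Step (reverse (map p (allFin (suc K))) ++ map q (allFin (suc K))) backOut-walk (adjacent s)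
      where
      P Q : List A
      P = tabulate p ++ z ∷ []
      Q = tabulate q ++ z ∷ []
      adjacent : BackOutStep u v → Adjacent (reverse P ++ Q) u v
      adjacent enter    = Adjacent-++⁺ˡ Q (Adjacent-reverse⁺ P (Adjacent-++⁺-join (z ∷ []) (Last-tabulate⁺ p) refl))
      adjacent (back k) = Adjacent-++⁺ˡ Q (Adjacent-reverse⁺ P (Adjacent-++⁺ˡ (z ∷ []) (Adjacent-tabulate⁺ p k)))
      adjacent turn     = Adjacent-++⁺-join Q (Last-reverse⁺ P refl) refl
      adjacent (out k)  = Adjacent-++⁺ʳ (reverse P) (Adjacent-++⁺ˡ (z ∷ []) (Adjacent-tabulate⁺ q k))
      adjacent leave    = Adjacent-++⁺ʳ (reverse P) (Adjacent-++⁺-join (z ∷ []) (Last-tabulate⁺ q) refl)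

module _ {K : ℕ} where

  data Position : Fin (suc (suc K)) → Set where
    first  : Position zero
    middle : (k : Fin K) → Position (suc (inject₁ k))
    final  : Position (fromℕ (suc K))

  position : (e : Fin (suc (suc K))) → Position e
  position zero = first
  position (suc e) with Top.view e
  ... | ‵fromℕ     = final
  ... | ‵inject₁ k = middle k

suc≢inject₁ : ∀ {K} (k : Fin K) → suc k ≢ inject₁ k
suc≢inject₁ zero    ()
suc≢inject₁ (suc k) e = suc≢inject₁ k (suc-injective e)

inject₁²≢suc² : ∀ {K} (k : Fin K) → inject₁ (inject₁ k) ≢ suc (suc k)
inject₁²≢suc² zero    ()
inject₁²≢suc² (suc k) e = inject₁²≢suc² k (suc-injective e)

injective⇒surjective : ∀ {K} (f : Fin (suc K) → Fin (suc K)) → Injective _≡_ _≡_ f → ∀ y → ∃ λ x → f x ≡ y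
injective⇒surjective {K} f f-injective y with any? (λ x → f x ≟ᶠ y)
... | yes found = found
... | no ¬found = ⊥-elim (<-irrefl refl (injective⇒≤ punchOut-injective′))
  where
  missed : ∀ x → y ≢ f x
  missed x e = ¬found (x , sym e)
  punchOut-injective′ : Injective _≡_ _≡_ (λ x → punchOut (missed x))
  punchOut-injective′ {x} {x′} e = f-injective (punchOut-injective (missed x) (missed x′) e)

module _ {V : Set} (σ : V ↔ V) where
  open Inverse σ

  mapsCycle-to : ∀ {c d x y} → MapsCycle σ c d → IsEdge c x y → IsEdge d (to x) (to y)
  mapsCycle-to σcd = Equivalence.to (σcd _ _)

  mapsCycle-from : ∀ {c d x y} → MapsCycle σ c d → IsEdge d x y → IsEdge c (from x) (from y)
  mapsCycle-from {d = d} σcd e =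
    Equivalence.from (σcd _ _) (subst₂ (IsEdge d) (sym (strictlyInverseˡ _)) (sym (strictlyInverseˡ _)) e)

module CycleSystem {I V : Set} (C : I → List V) where

  Edge : I → V → V → Set
  Edge c = IsEdge (C c)

  Edge-sym : ∀ t {u v} → Edge t u v → Edge t v u
  Edge-sym t (inj₁ uv) = inj₂ uv
  Edge-sym t (inj₂ vu) = inj₁ vu

  NeighbourPair : I → V → V → V → Set
  NeighbourPair c w u u′ = u ≢ u′ × Edge c w u × Edge c w u′

  Splits : I → V → I → Set
  Splits s w t = ∃₂ λ u u′ → NeighbourPair s w u u′ × ¬ Edge t u u′

  record NonRigid (w : V) : Set where
    constructor non-rigid
    field
      t s        : I
      u u′       : V
      neighbours : NeighbourPair t w u u′
      joined     : Edge s u u′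
      splits     : Splits s w t

  NonRigid-reflect : (σ : V ↔ V) → (∀ s → ∃ λ t → MapsCycle σ (C t) (C s)) →
                     ∀ {w} → NonRigid (Inverse.to σ w) → NonRigid w
  NonRigid-reflect σ preimage {w} (non-rigid t s u u′ pair joined (v , v′ , pair′ , apart))
    with preimage t | preimage s
  ... | t₀ , σt | s₀ , σs =
    non-rigid t₀ s₀ (from u) (from u′) (pull σt pair) (mapsCycle-from σ {C s₀} {C s} σs joined)
      (from v , from v′ , pull σs pair′ , λ e → apart (push σt e))
    where
    open Inverse σ
    pull : ∀ {a b x x′} → MapsCycle σ (C a) (C b) → NeighbourPair b (to w) x x′ → NeighbourPair a w (from x) (from x′)
    pull {a} {b} σab (x≢x′ , wx , wx′) =
      (λ e → x≢x′ (trans (sym (strictlyInverseˡ _)) (trans (cong to e) (strictlyInverseˡ _)))) ,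
      subst (λ y → Edge a y _) (strictlyInverseʳ w) (mapsCycle-from σ {C a} {C b} σab wx) ,
      subst (λ y → Edge a y _) (strictlyInverseʳ w) (mapsCycle-from σ {C a} {C b} σab wx′)
    push : ∀ {a b} → MapsCycle σ (C a) (C b) → Edge a (from v) (from v′) → Edge b v v′
    push {a} {b} σab e = subst₂ (Edge b) (strictlyInverseˡ v) (strictlyInverseˡ v′) (mapsCycle-to σ {C a} {C b} σab e)

module Doubling (m : ℕ) where

  n : ℕ
  n = suc (suc m)

  -- 2 * n reduces to suc (suc K), so Fin (2 * n) is Fin (suc (suc K)) by definition.
  K : ℕ
  K = pred (pred (2 * n))

  last penultimate one : Fin (2 * n)
  last        = fromℕ (suc K)
  penultimate = inject₁ (fromℕ K)
  one         = suc zero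

  endpoint : Bool → Fin (2 * n)
  endpoint true  = zero
  endpoint false = last

  endpoint-injective : ∀ {c c′} → endpoint c ≡ endpoint c′ → c ≡ c′
  endpoint-injective {true}  {true}  _ = refl
  endpoint-injective {false} {false} _ = refl
  endpoint-injective {true}  {false} ()
  endpoint-injective {false} {true}  ()

  endpoint-ends : ∀ c → toℕ (endpoint c) ≡ 0 ⊎ suc (toℕ (endpoint c)) ≡ 2 * n
  endpoint-ends true  = inj₁ refl
  endpoint-ends false = inj₂ (cong suc (toℕ-fromℕ (suc K)))

  K≢0 : K ≢ 0
  K≢0 K≡0 = 1+n≢0 (m+n≡0⇒n≡0 m K≡0)

  one≢last : one ≢ last
  one≢last e = K≢0 (trans (sym (toℕ-fromℕ K)) (sym (cong toℕ (suc-injective e))))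

  penultimate≢zero : penultimate ≢ zero
  penultimate≢zero e = K≢0 (trans (sym (toℕ-fromℕ K)) (trans (sym (toℕ-inject₁ (fromℕ K))) (cong toℕ e)))

  penultimate≢last : penultimate ≢ last
  penultimate≢last e = fromℕ≢inject₁ (sym e)

  module HCS (α : Fin n → Fin (2 * n) → Fin (2 * n)) (hcs : IsHCSSeq n α) where

    injective : ∀ i → Injective _≡_ _≡_ (α i)
    injective = proj₁ hcs

    surjective : ∀ i y → ∃ λ e → α i e ≡ y
    surjective i = injective⇒surjective (α i) (injective i)

    ∞-edge : ∀ i c → IsEdge (baseCycle n (α i)) nothing (just (α i (endpoint c)))
    ∞-edge i true  = inj₁ (loop-step⁺ nothing (just ∘ α i) enter)
    ∞-edge i false = inj₂ (loop-step⁺ nothing (just ∘ α i) leave)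

    endpoint-cycle-injective : ∀ {i j} c c′ → α i (endpoint c) ≡ α j (endpoint c′) → i ≡ j × c ≡ c′
    endpoint-cycle-injective {i} {j} c c′ e
      with proj₂ (proj₂ hcs) nothing (just (α j (endpoint c′))) i j
             (subst (λ x → IsEdge (baseCycle n (α i)) nothing (just x)) e (∞-edge i c)) (∞-edge j c′)
    ... | refl = refl , endpoint-injective (injective i e)

    endpoint-cover : ∀ x → ∃₂ λ i c → x ≡ α i (endpoint c)
    endpoint-cover x with proj₁ (proj₂ hcs) nothing (just x) (λ ())
    ... | i , inj₁ st with loop-step⁻ nothing (just ∘ α i) st
    ...   | enter = i , true , refl
    endpoint-cover x | i , inj₂ st with loop-step⁻ nothing (just ∘ α i) st
    ...   | leave = i , false , refl

  module 𝒯 (α β γ : Fin n → Fin (2 * n) → Fin (2 * n))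
           (hα : IsHCSSeq n α) (hβ : IsHCSSeq n β) (hγ : IsHCSSeq n γ)
           (ends : EndsAgree n α β γ) where

    open CycleSystem (Tcyc n α β γ) public
    private
      module Γ = HCS γ hγ

    V : Set
    V = TV n

    -- T_{i,1} runs along α i through the vertices of sign true and back along β i through
    -- those of sign false.
    path : Bool → Fin n → Fin (2 * n) → Fin (2 * n)
    path true  = α
    path false = β

    path-hcs : ∀ b → IsHCSSeq n (path b)
    path-hcs true  = hα
    path-hcs false = hβ

    module Path (b : Bool) = HCS (path b) (path-hcs b)

    path-endpoint : ∀ b i c → path b i (endpoint c) ≡ γ i (endpoint c)
    path-endpoint true  i c = proj₂ (ends i (endpoint c) (endpoint-ends c))
    path-endpoint false i c with ends i (endpoint c) (endpoint-ends c)
    ... | α≡β , α≡γ = trans (sym α≡β) α≡γ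

    half : Bool → Fin n → Fin (2 * n) → V
    half b i e = just (path b i e , b)

    descending ascending : Fin n → Fin (2 * n) → V
    descending i e = just (γ i e , not (isEven (toℕ e)))
    ascending  i e = just (γ i e , isEven (toℕ e))

    private
      variable
        i : Fin n
        u v : V

      T1-step⁻ : Step (T1 n α β i) u v → OutBackStep nothing (half true i) (half false i) u v
      T1-step⁻ {i} = outBack-step⁻ nothing (half true i) (half false i)

      T1-step⁺ : OutBackStep nothing (half true i) (half false i) u v → Step (T1 n α β i) u v
      T1-step⁺ {i} = outBack-step⁺ nothing (half true i) (half false i)

      T2-step⁻ : Step (T2 n γ i) u v → BackOutStep nothing (descending i) (ascending i) u v
      T2-step⁻ {i} = backOut-step⁻ nothing (descending i) (ascending i)

      T2-step⁺ : BackOutStep nothing (descending i) (ascending i) u v → Step (T2 n γ i) u v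
      T2-step⁺ {i} = backOut-step⁺ nothing (descending i) (ascending i)

      isEven-inject₁ : ∀ {N} (k : Fin N) → isEven (toℕ (inject₁ k)) ≡ isEven (toℕ k)
      isEven-inject₁ k = cong isEven (toℕ-inject₁ k)

    T1-∞ : ∀ i b → Edge (i , true) nothing (half b i zero)
    T1-∞ i true  = inj₁ (T1-step⁺ enter)
    T1-∞ i false = inj₂ (T1-step⁺ leave)

    T1-path : ∀ i b k → Edge (i , true) (half b i (inject₁ k)) (half b i (suc k))
    T1-path i true  k = inj₁ (T1-step⁺ (out k))
    T1-path i false k = inj₂ (T1-step⁺ (back k))

    T1-lift : ∀ i b {x y} → IsEdge (baseCycle n (path b i)) (just x) (just y) →
              Edge (i , true) (just (x , b)) (just (y , b))
    T1-lift i b (inj₁ st) with loop-step⁻ nothing (just ∘ path b i) st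
    ... | walk k = T1-path i b k
    T1-lift i b (inj₂ st) with loop-step⁻ nothing (just ∘ path b i) st
    ... | walk k = Edge-sym (i , true) (T1-path i b k)

    T1-sign-change : ∀ {x b y c} → Step (T1 n α β i) (just (x , b)) (just (y , c)) → c ≡ not b → x ≡ γ i last
    T1-sign-change {i} st c≡¬b with T1-step⁻ st | c≡¬b
    ... | out _  | ()
    ... | turn   | _  = path-endpoint true i false
    ... | back _ | ()

    T2-∞ : ∀ i b → Edge (i , false) nothing (just (γ i last , b))
    T2-∞ i b with b ≟ᵇ isEven (toℕ last)
    ... | yes refl = inj₂ (T2-step⁺ leave)
    ... | no  b≢   rewrite ¬-not b≢ = inj₁ (T2-step⁺ enter)

    T2-turn : ∀ i → Edge (i , false) (just (γ i zero , false)) (just (γ i zero , true))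
    T2-turn i = inj₁ (T2-step⁺ turn)

    T2-out : ∀ i k b → Edge (i , false) (just (γ i (inject₁ k) , b)) (just (γ i (suc k) , not b))
    T2-out i k b with b ≟ᵇ isEven (toℕ k)
    ... | yes refl = subst (λ s → Edge (i , false) (just (γ i (inject₁ k) , s)) (ascending i (suc k)))
                       (isEven-inject₁ k) (inj₁ (T2-step⁺ (out k)))
    ... | no  b≢   rewrite ¬-not b≢ =
      subst (λ s → Edge (i , false) (just (γ i (inject₁ k) , not s)) (descending i (suc k)))
        (isEven-inject₁ k) (inj₂ (T2-step⁺ (back k)))

    T2-out′ : ∀ i k b → Edge (i , false) (just (γ i (suc k) , b)) (just (γ i (inject₁ k) , not b))
    T2-out′ i k b = subst (λ s → Edge (i , false) (just (γ i (suc k) , s)) (just (γ i (inject₁ k) , not b)))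
                      (not-involutive b) (Edge-sym (i , false) (T2-out i k (not b)))

    T2-sign : ∀ {x b y c} → Step (T2 n γ i) (just (x , b)) (just (y , c)) → c ≡ not b
    T2-sign st with T2-step⁻ st
    ... | back k = cong not (trans (isEven-inject₁ k) (sym (not-involutive _)))
    ... | turn   = refl
    ... | out k  = cong not (sym (isEven-inject₁ k))

    T2-alternating : ∀ i {x y b} → ¬ Edge (i , false) (just (x , b)) (just (y , b))
    T2-alternating i (inj₁ st) = not-¬ refl (T2-sign st)
    T2-alternating i (inj₂ st) = not-¬ refl (T2-sign st)

    T2-twin : ∀ {x b y c} → Step (T2 n γ i) (just (x , b)) (just (y , c)) → x ≡ y → x ≡ γ i zero
    T2-twin {i} st x≡y with T2-step⁻ st
    ... | back k = ⊥-elim (suc≢inject₁ k (Γ.injective i x≡y))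
    ... | turn   = refl
    ... | out k  = ⊥-elim (suc≢inject₁ k (sym (Γ.injective i x≡y)))

    ∞-value twin-value : Fin n × Bool → Fin (2 * n)
    ∞-value    (i , c) = γ i (endpoint c)
    twin-value (i , c) = γ i (endpoint (not c))

    ∞-edge : ∀ t b → Edge t nothing (just (∞-value t , b))
    ∞-edge (i , true)  b = subst (λ x → Edge (i , true) nothing (just (x , b))) (path-endpoint b i true) (T1-∞ i b)
    ∞-edge (i , false) b = T2-∞ i b

    ∞-neighbour : ∀ t → Edge t nothing u → ∃ λ b → u ≡ just (∞-value t , b)
    ∞-neighbour (i , true) (inj₁ st) with T1-step⁻ st
    ... | enter = true , cong (λ x → just (x , true)) (path-endpoint true i true)
    ∞-neighbour (i , true) (inj₂ st) with T1-step⁻ st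
    ... | leave = false , cong (λ x → just (x , false)) (path-endpoint false i true)
    ∞-neighbour (i , false) (inj₁ st) with T2-step⁻ st
    ... | enter = _ , refl
    ∞-neighbour (i , false) (inj₂ st) with T2-step⁻ st
    ... | leave = _ , refl

    ∞-twins : ∀ t {u u′} → u ≢ u′ → Edge t nothing u → Edge t nothing u′ →
              ∃ λ b → u ≡ just (∞-value t , b) × u′ ≡ just (∞-value t , not b)
    ∞-twins t u≢u′ tu tu′ with ∞-neighbour t tu | ∞-neighbour t tu′
    ... | b , refl | b′ , refl = b , refl , cong (λ c → just (∞-value t , c)) (¬-not (λ b′≡b → u≢u′ (cong (λ c → just (∞-value t , c)) (sym b′≡b))))

    twin-edge : ∀ t b → Edge t (just (twin-value t , b)) (just (twin-value t , not b))
    twin-edge (i , true) true = subst₂ (λ x y → Edge (i , true) (just (x , true)) (just (y , false)))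
                                  (path-endpoint true i false) (path-endpoint false i false) (inj₁ (T1-step⁺ turn))
    twin-edge (i , true)  false = Edge-sym (i , true) (twin-edge (i , true) true)
    twin-edge (i , false) true  = Edge-sym (i , false) (T2-turn i)
    twin-edge (i , false) false = T2-turn i

    twin-edge⁻ : ∀ t {x b} → Edge t (just (x , b)) (just (x , not b)) → x ≡ twin-value t
    twin-edge⁻ (i , true)  (inj₁ st) = T1-sign-change st refl
    twin-edge⁻ (i , true)  {b = b} (inj₂ st) = T1-sign-change st (sym (not-involutive b))
    twin-edge⁻ (i , false) (inj₁ st) = T2-twin st refl
    twin-edge⁻ (i , false) (inj₂ st) = T2-twin st refl

    ∞-value≡twin-value : ∀ t s → ∞-value t ≡ twin-value s → ∞-value s ≡ twin-value t
    ∞-value≡twin-value (i , c) (j , c′) e with Γ.endpoint-cycle-injective c (not c′) e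
    ... | refl , refl = cong (γ i ∘ endpoint) (sym (not-involutive c′))

    ∞-rigid : ¬ NonRigid nothing
    ∞-rigid (non-rigid t s u u′ (u≢u′ , tu , tu′) joined (v , v′ , (v≢v′ , sv , sv′) , apart))
      with ∞-twins t u≢u′ tu tu′ | ∞-twins s v≢v′ sv sv′
    ... | _ , refl , refl | c , refl , refl =
      apart (subst (λ x → Edge t (just (x , c)) (just (x , not c)))
                   (sym (∞-value≡twin-value t s (twin-edge⁻ s joined))) (twin-edge t c))

    SameSignPair : Fin n × Bool → V → Set
    SameSignPair s w = ∃ λ b → ∃₂ λ x y → NeighbourPair s w (just (x , b)) (just (y , b))

    sameSign⇒splits : ∀ s {w} i → SameSignPair s w → Splits s w (i , false)
    sameSign⇒splits s i (_ , _ , _ , pair) = _ , _ , pair , T2-alternating i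

    T1-middle-neighbours : ∀ l b k → SameSignPair (l , true) (half b l (suc (inject₁ k)))
    T1-middle-neighbours l b k =
      b , _ , _ ,
      (λ e → inject₁²≢suc² k (Path.injective b l (,-injectiveˡ (just-injective e)))) ,
      Edge-sym (l , true) (T1-path l b (inject₁ k)) ,
      T1-path l b (suc k)

    T2-start-neighbours : ∀ l b → NeighbourPair (l , false) (just (γ l zero , b)) (just (γ l zero , not b)) (just (γ l one , not b))
    T2-start-neighbours l b =
      (λ e → 0≢1+n (Γ.injective l (,-injectiveˡ (just-injective e)))) ,
      twin-edge (l , false) b ,
      T2-out l zero b

    T2-end-neighbours : ∀ i b → NeighbourPair (i , false) (just (γ i last , b)) nothing (just (γ i penultimate , not b))
    T2-end-neighbours i b = (λ ()) , Edge-sym (i , false) (∞-edge (i , false) b) , T2-out′ i (fromℕ K) b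

    T2-neighbours : ∀ l b {e} → e ≢ last → SameSignPair (l , false) (just (γ l e , b))
    T2-neighbours l b {e} e≢last with position e
    ... | first    = not b , _ , _ , T2-start-neighbours l b
    ... | middle k =
      not b , _ , _ ,
      (λ e → inject₁²≢suc² k (Γ.injective l (,-injectiveˡ (just-injective e)))) ,
      T2-out′ l (inject₁ k) b ,
      T2-out l (suc k) b
    ... | final    = ⊥-elim (e≢last refl)

    T1-splits-start : ∀ i l b → Splits (l , true) (just (γ i zero , b)) (i , false)
    T1-splits-start i l b with Path.surjective b l (γ i zero)
    ... | e , pe with position e
    ...   | middle k = sameSign⇒splits (l , true) i
                         (subst (λ x → SameSignPair (l , true) (just (x , b))) pe (T1-middle-neighbours l b k))
    ...   | final with Path.endpoint-cycle-injective b false true (trans pe (sym (path-endpoint b i true)))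
    ...     | _ , ()
    T1-splits-start i l b | e , pe | first with Path.endpoint-cycle-injective b true true (trans pe (sym (path-endpoint b i true)))
    ...     | refl , _ = nothing , half b i one , pair , apart
      -- w is next to ∞ on T_{i,1}, and its other neighbour there is not an end of γ i.
      where
      pair : NeighbourPair (i , true) (just (γ i zero , b)) nothing (half b i one)
      pair = subst (λ x → NeighbourPair (i , true) (just (x , b)) nothing (half b i one)) pe
               ((λ ()) , Edge-sym (i , true) (T1-∞ i b) , T1-path i b zero)
      apart : ¬ Edge (i , false) nothing (half b i one)
      apart e with ∞-neighbour (i , false) e
      ... | _ , e′ = one≢last (Path.injective b i (trans (,-injectiveˡ (just-injective e′)) (sym (path-endpoint b i false))))

    T1-splits-end : ∀ i l b → γ i penultimate ≡ α l zero → Splits (l , true) (just (γ i last , b)) (i , false)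
    T1-splits-end i l b h with Path.surjective b l (γ i last)
    ... | e , pe with position e
    ...   | middle k = sameSign⇒splits (l , true) i
                         (subst (λ x → SameSignPair (l , true) (just (x , b))) pe (T1-middle-neighbours l b k))
    ...   | first with Path.endpoint-cycle-injective b true false (trans pe (sym (path-endpoint b i false)))
    ...     | _ , ()
    T1-splits-end i l b h | e , pe | final with Path.endpoint-cycle-injective b false false (trans pe (sym (path-endpoint b i false)))
    ...     | refl , _ = ⊥-elim (penultimate≢zero (Γ.injective i (trans h (path-endpoint true i true))))

    T2-splits-end : ∀ i l b → γ i penultimate ≡ α l last → Splits (l , false) (just (γ i last , b)) (i , false)
    T2-splits-end i l b h with Γ.surjective l (γ i last)
    ... | e , γe with e ≟ᶠ last
    ...   | no e≢last = sameSign⇒splits (l , false) i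
                          (subst (λ x → SameSignPair (l , false) (just (x , b))) γe (T2-neighbours l b e≢last))
    ...   | yes refl with Γ.endpoint-cycle-injective false false γe
    ...     | refl , _ = ⊥-elim (penultimate≢last (Γ.injective i (trans h (path-endpoint true i false))))

    γ-start-non-rigid : ∀ i b → NonRigid (just (γ i zero , b))
    γ-start-non-rigid i b with proj₁ (proj₂ (path-hcs (not b))) (just (γ i zero)) (just (γ i one)) zero≢one
      where
      zero≢one : just (γ i zero) ≢ just (γ i one)
      zero≢one e = 0≢1+n (Γ.injective i (just-injective e))
    ... | l , edge = non-rigid (i , false) (l , true) _ _ (T2-start-neighbours i b) (T1-lift l (not b) edge) (T1-splits-start i l b)

    γ-end-non-rigid : ∀ i b → NonRigid (just (γ i last , b))
    γ-end-non-rigid i b with HCS.endpoint-cover α hα (γ i penultimate)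
    ... | l , true , h =
      non-rigid (i , false) (l , true) _ _ (T2-end-neighbours i b)
        (subst (λ x → Edge (l , true) nothing (just (x , not b))) (sym (trans h (path-endpoint true l true))) (∞-edge (l , true) (not b)))
        (T1-splits-end i l b h)
    ... | l , false , h =
      non-rigid (i , false) (l , false) _ _ (T2-end-neighbours i b)
        (subst (λ x → Edge (l , false) nothing (just (x , not b))) (sym (trans h (path-endpoint true l false))) (∞-edge (l , false) (not b)))
        (T2-splits-end i l b h)

    finite-non-rigid : ∀ x b → NonRigid (just (x , b))
    finite-non-rigid x b with Γ.endpoint-cover x
    ... | i , true  , refl = γ-start-non-rigid i b
    ... | i , false , refl = γ-end-non-rigid i b

lemma2 : (n : ℕ) → 1 < n →
    (α β γ : Fin n → Fin (2 * n) → Fin (2 * n)) →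
    IsHCSSeq n α → IsHCSSeq n β → IsHCSSeq n γ →
    EndsAgree n α β γ →
    (σ : TV n ↔ TV n) → IsAutT n α β γ σ →
    Inverse.to σ nothing ≡ nothing
lemma2 (suc zero) (s≤s ())
lemma2 (suc (suc m)) _ α β γ hα hβ hγ ends σ aut with Inverse.to σ nothing in σ∞
... | nothing      = refl
... | just (x , b) =
  ⊥-elim (∞-rigid (NonRigid-reflect σ (proj₂ aut) (subst NonRigid (sym σ∞) (finite-non-rigid x b))))
  where open Doubling.𝒯 m α β γ hα hβ hγ ends
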